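{- The cut rule is admissible in $\mathsf{GWF}$: for all finite multisets $\Gamma,\Gamma',\Delta,\Delta'$ of formulas and every formula $D$, if $\Gamma\Rightarrow D,\Delta$ and $D,\Gamma'\Rightarrow\Delta'$ are both derivable in $\mathsf{GWF}$, then $\Gamma,\Gamma'\Rightarrow\Delta,\Delta'$ is derivable in $\mathsf{GWF}$.
   Context: Formulas are built from a countable set of propositional atoms $p,q,\dots$ and the constant $\bot$ using the binary connectives $\wedge,\vee,\rightarrow$. A sequent $\Gamma\Rightarrow\Delta$ consists of two finite, possibly empty, multisets $\Gamma,\Delta$ of formulas; commas denote multiset union. The calculus $\mathsf{GWF}$ has the following rules ($p$ atomic, $\Gamma,\Delta$ arbitrary multisets): (Ax) $p,\Gamma\Rightarrow\Delta,p$ with no premises; ($\bot_L$) $\bot,\Gamma\Rightarrow\Delta$ with no premises; ($\wedge_L$) from $A,B,\Gamma\Rightarrow\Delta$ infer $A\wedge B,\Gamma\Rightarrow\Delta$; ($\wedge_R$) from $\Gamma\Rightarrow\Delta,A$ and $\Gamma\Rightarrow\Delta,B$ infer $\Gamma\Rightarrow\Delta,A\wedge B$; ($\vee_L$) from $A,\Gamma\Rightarrow\Delta$ and $B,\Gamma\Rightarrow\Delta$ infer $A\vee B,\Gamma\Rightarrow\Delta$; ($\vee_R$) from $\Gamma\Rightarrow\Delta,A,B$ infer $\Gamma\Rightarrow\Delta,A\vee B$; ($\rightarrow_R$) from $A\Rightarrow B$ infer $\Gamma\Rightarrow A\rightarrow B,\Delta$; ($\rightarrow_{LR}$) from $A\Rightarrow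 B$, $B\Rightarrow A$, $C\Rightarrow D$, $D\Rightarrow C$ infer $\Gamma,A\rightarrow C\Rightarrow B\rightarrow D,\Delta$. A sequent is derivable in $\mathsf{GWF}$ if it is the root of a finite tree built from these rules (no cut rule is part of the calculus). -}

module Defs where

open import Data.Nat using (ℕ)
open import Data.List using (List; []; _∷_; _++_; [_])
open import Data.List.Relation.Binary.Permutation.Propositional using (_↭_)

data Formula : Set where
  atom : ℕ → Formula
  ⊥'   : Formula
  _∧'_ : Formula → Formula → Formula
  _∨'_ : Formula → Formula → Formula
  _⇒'_ : Formula → Formula → Formula

-- Finite multisets of formulas are represented as lists, considered up to
-- permutation (_↭_).  Each rule concludes any sequent whose antecedent and
-- succedent are permutations of the displayed ones, so derivability is a
-- property of the pair of multisets.
Ctx : Set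
Ctx = List Formula

data Derivable : Ctx → Ctx → Set where
  ax   : ∀ {Γ Δ Γ₀ Δ₀} p →
         Γ₀ ↭ (atom p ∷ Γ) → Δ₀ ↭ (Δ ++ [ atom p ]) →
         Derivable Γ₀ Δ₀
  ⊥L   : ∀ {Γ Δ Γ₀} →
         Γ₀ ↭ (⊥' ∷ Γ) →
         Derivable Γ₀ Δ
  ∧L   : ∀ {A B Γ Δ Γ₀} →
         Γ₀ ↭ ((A ∧' B) ∷ Γ) →
         Derivable (A ∷ B ∷ Γ) Δ →
         Derivable Γ₀ Δ
  ∧R   : ∀ {A B Γ Δ Δ₀} →
         Δ₀ ↭ (Δ ++ [ A ∧' B ]) →
         Derivable Γ (Δ ++ [ A ]) → Derivable Γ (Δ ++ [ B ]) →
         Derivable Γ Δ₀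
  ∨L   : ∀ {A B Γ Δ Γ₀} →
         Γ₀ ↭ ((A ∨' B) ∷ Γ) →
         Derivable (A ∷ Γ) Δ → Derivable (B ∷ Γ) Δ →
         Derivable Γ₀ Δ
  ∨R   : ∀ {A B Γ Δ Δ₀} →
         Δ₀ ↭ (Δ ++ (A ∨' B) ∷ []) →
         Derivable Γ (Δ ++ A ∷ B ∷ []) →
         Derivable Γ Δ₀
  ⇒R   : ∀ {A B Γ Δ Δ₀} →
         Δ₀ ↭ ((A ⇒' B) ∷ Δ) →
         Derivable [ A ] [ B ] →
         Derivable Γ Δ₀
  ⇒LR  : ∀ {A B C D Γ Δ Γ₀ Δ₀} →
         Γ₀ ↭ (Γ ++ [ A ⇒' C ]) → Δ₀ ↭ ((B ⇒' D) ∷ Δ) →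
         Derivable [ A ] [ B ] → Derivable [ B ] [ A ] →
         Derivable [ C ] [ D ] → Derivable [ D ] [ C ] →
         Derivable Γ₀ Δ₀

{-# OPTIONS --safe #-}
-- Cut on D is eliminated by induction on D. Within it, the left premise Γ ⇒ D, Δ is rebuilt rule by
-- rule with D deleted: a rule in which D is not principal is simply reapplied, and the right premise
-- D, Γ ⇒ Δ can follow it into its premises because the ∧ and ∨ rules are invertible. Where D is
-- principal, the right premise is inverted and cut on the immediate subformulas (∧, ∨), or the atom
-- is contracted (axiom). For D = B → E the left occurrences of D in the right premise are traced
-- instead: they can only be principal in →LR, whose premises are interderivabilities, and these
-- compose with those of the left premise by cuts on B and E. Contraction is only ever needed for
-- atoms and implications.
module Submission where

open import Data.Empty using (⊥-elim)
open import Data.Nat using (ℕ)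
open import Data.List using (List; []; _∷_; _++_; [_])
open import Data.List.Membership.Propositional using (_∈_)
open import Data.List.Membership.Propositional.Properties using (∈-∃++; ∈-++⁺ˡ; ∈-++⁺ʳ)
open import Data.List.Relation.Unary.Any using (here; there)
open import Data.List.Relation.Binary.Permutation.Propositional
  using (_↭_; ↭-refl; ↭-sym; ↭-trans; ↭-prep; ↭-swap)
open import Data.List.Relation.Binary.Permutation.Propositional.Properties
  using (∈-resp-↭; shift; shifts; ++-comm; ++-identityʳ; ++⁺ˡ; ++⁺ʳ; drop-∷; ∷↭∷ʳ)
open import Data.Product using (∃; _×_; _,_)
open import Data.Unit using (⊤; tt)
open import Relation.Binary.PropositionalEquality using (refl)
open import Relation.Nullary using (¬_)

open import Defs

infixr 5 _⟫_

_⟫_ : {A : Set} {xs ys zs : List A} → xs ↭ ys → ys ↭ zs → xs ↭ zs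
_⟫_ = ↭-trans

module _ {A : Set} where

  private
    variable
      x y : A
      xs ys zs : List A

  ∈⇒↭∷ : x ∈ xs → ∃ λ ys → xs ↭ x ∷ ys
  ∈⇒↭∷ x∈xs with us , vs , refl ← ∈-∃++ x∈xs = us ++ vs , shift _ us vs

  ↭∷⇒∈ : xs ↭ x ∷ ys → x ∈ xs
  ↭∷⇒∈ p = ∈-resp-↭ (↭-sym p) (here refl)

  ∷ʳ↭ : ∀ xs → xs ++ [ x ] ↭ x ∷ xs
  ∷ʳ↭ {x} xs = ↭-sym (∷↭∷ʳ x xs)

  ↭∷ʳ⇒∈ : xs ↭ ys ++ [ x ] → x ∈ xs
  ↭∷ʳ⇒∈ {ys = ys} p = ↭∷⇒∈ (p ⟫ ∷ʳ↭ ys)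

  ↭∷-under : ∀ ws → xs ↭ x ∷ zs → ws ++ xs ↭ x ∷ ws ++ zs
  ↭∷-under {x = x} {zs = zs} ws p = ++⁺ˡ ws p ⟫ shift x ws zs

  data HeadMatch (x : A) (xs : List A) : A → List A → Set where
    same  : xs ↭ ys → HeadMatch x xs x ys
    other : ∀ zs → xs ↭ y ∷ zs → ys ↭ x ∷ zs → HeadMatch x xs y ys

  matchHeads : x ∷ xs ↭ y ∷ ys → HeadMatch x xs y ys
  matchHeads {x} {y = y} p with ∈-resp-↭ p (here refl)
  ... | here refl = same (drop-∷ p)
  ... | there x∈ys with zs , ys↭ ← ∈⇒↭∷ x∈ys =
    other zs (drop-∷ (p ⟫ ↭-prep y ys↭ ⟫ ↭-swap y x ↭-refl)) ys↭

private
  variable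
    p : ℕ
    A B C D E X Z : Formula
    Γ Γ′ Γ₀ Δ Δ′ Δ₀ : Ctx

_⊢_ : Formula → Formula → Set
A ⊢ B = Derivable [ A ] [ B ]

_⟺_ : Formula → Formula → Set
A ⟺ B = A ⊢ B × B ⊢ A

reorder : Derivable Γ Δ → Γ ↭ Γ′ → Δ ↭ Δ′ → Derivable Γ′ Δ′
reorder (ax p g h)         q r = ax p (↭-sym q ⟫ g) (↭-sym r ⟫ h)
reorder (⊥L g)             q r = ⊥L (↭-sym q ⟫ g)
reorder (∧L g d)           q r = ∧L (↭-sym q ⟫ g) (reorder d ↭-refl r)
reorder (∧R h d e)         q r = ∧R (↭-sym r ⟫ h) (reorder d q ↭-refl) (reorder e q ↭-refl)
reorder (∨L g d e)         q r = ∨L (↭-sym q ⟫ g) (reorder d ↭-refl r) (reorder e ↭-refl r)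
reorder (∨R h d)           q r = ∨R (↭-sym r ⟫ h) (reorder d q ↭-refl)
reorder (⇒R h d)           q r = ⇒R (↭-sym r ⟫ h) d
reorder (⇒LR g h a b c e)  q r = ⇒LR (↭-sym q ⟫ g) (↭-sym r ⟫ h) a b c e

ax∈ : atom p ∈ Γ → atom p ∈ Δ → Derivable Γ Δ
ax∈ {p} m n with Γ′ , g ← ∈⇒↭∷ m | Δ′ , h ← ∈⇒↭∷ n = ax p g (h ⟫ ∷↭∷ʳ (atom p) Δ′)

⊥L∈ : ⊥' ∈ Γ → Derivable Γ Δ
⊥L∈ m with Γ′ , g ← ∈⇒↭∷ m = ⊥L g

∧R↭ : Δ₀ ↭ A ∧' B ∷ Δ → Derivable Γ (A ∷ Δ) → Derivable Γ (B ∷ Δ) → Derivable Γ Δ₀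
∧R↭ {Δ = Δ} h d e =
  ∧R (h ⟫ ∷↭∷ʳ _ Δ) (reorder d ↭-refl (∷↭∷ʳ _ Δ)) (reorder e ↭-refl (∷↭∷ʳ _ Δ))

∨R↭ : Δ₀ ↭ A ∨' B ∷ Δ → Derivable Γ (A ∷ B ∷ Δ) → Derivable Γ Δ₀
∨R↭ {A = A} {B = B} {Δ = Δ} h d =
  ∨R (h ⟫ ∷↭∷ʳ _ Δ) (reorder d ↭-refl (++-comm (A ∷ B ∷ []) Δ))

⇒R∈ : A ⇒' B ∈ Δ → A ⊢ B → Derivable Γ Δ
⇒R∈ m d with Δ′ , h ← ∈⇒↭∷ m = ⇒R h d

⇒LR∈ : A ⇒' C ∈ Γ → B ⇒' D ∈ Δ → A ⟺ B → C ⟺ D → Derivable Γ Δ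
⇒LR∈ m n (a , b) (c , e) with Γ′ , g ← ∈⇒↭∷ m | Δ′ , h ← ∈⇒↭∷ n =
  ⇒LR (g ⟫ ∷↭∷ʳ _ Γ′) h a b c e

weaken : ∀ Γ′ Δ′ → Derivable Γ Δ → Derivable (Γ ++ Γ′) (Δ ++ Δ′)
weaken Γ′ Δ′ (ax p g h)         = ax∈ (∈-++⁺ˡ (↭∷⇒∈ g)) (∈-++⁺ˡ (↭∷ʳ⇒∈ h))
weaken Γ′ Δ′ (⊥L g)             = ⊥L∈ (∈-++⁺ˡ (↭∷⇒∈ g))
weaken Γ′ Δ′ (∧L g d)           = ∧L (++⁺ʳ Γ′ g) (weaken Γ′ Δ′ d)
weaken Γ′ Δ′ (∨L g d e)         = ∨L (++⁺ʳ Γ′ g) (weaken Γ′ Δ′ d) (weaken Γ′ Δ′ e)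
weaken Γ′ Δ′ (∧R {Δ = Δ} h d e) =
  ∧R↭ (++⁺ʳ Δ′ (h ⟫ ∷ʳ↭ Δ))
      (reorder (weaken Γ′ Δ′ d) ↭-refl (++⁺ʳ Δ′ (∷ʳ↭ Δ)))
      (reorder (weaken Γ′ Δ′ e) ↭-refl (++⁺ʳ Δ′ (∷ʳ↭ Δ)))
weaken Γ′ Δ′ (∨R {A = A} {B = B} {Δ = Δ} h d) =
  ∨R↭ (++⁺ʳ Δ′ (h ⟫ ∷ʳ↭ Δ))
      (reorder (weaken Γ′ Δ′ d) ↭-refl (++⁺ʳ Δ′ (++-comm Δ (A ∷ B ∷ []))))
weaken Γ′ Δ′ (⇒R h d)           = ⇒R (++⁺ʳ Δ′ h) d
weaken Γ′ Δ′ (⇒LR g h a b c e) =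
  ⇒LR∈ (∈-++⁺ˡ (↭∷ʳ⇒∈ g)) (∈-++⁺ˡ (↭∷⇒∈ h)) (a , b) (c , e)

data Principalˡ : Formula → Ctx → Ctx → Set where
  ax  : atom p ∈ Δ → Principalˡ (atom p) Γ Δ
  ⊥L  : Principalˡ ⊥' Γ Δ
  ∧L  : Derivable (A ∷ B ∷ Γ) Δ → Principalˡ (A ∧' B) Γ Δ
  ∨L  : Derivable (A ∷ Γ) Δ → Derivable (B ∷ Γ) Δ → Principalˡ (A ∨' B) Γ Δ
  ⇒LR : B ⇒' D ∈ Δ → A ⟺ B → C ⟺ D → Principalˡ (A ⇒' C) Γ Δ

data Principalʳ : Formula → Ctx → Ctx → Set where
  ax  : atom p ∈ Γ → Principalʳ (atom p) Γ Δ
  ∧R  : Derivable Γ (A ∷ Δ) → Derivable Γ (B ∷ Δ) → Principalʳ (A ∧' B) Γ Δ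
  ∨R  : Derivable Γ (A ∷ B ∷ Δ) → Principalʳ (A ∨' B) Γ Δ
  ⇒R  : A ⊢ B → Principalʳ (A ⇒' B) Γ Δ
  ⇒LR : A ⇒' C ∈ Γ → A ⟺ B → C ⟺ D → Principalʳ (B ⇒' D) Γ Δ

record InversionClosed (P : Ctx → Ctx → Set) : Set where
  field
    resp-↭ : P Γ Δ → Γ ↭ Γ′ → Δ ↭ Δ′ → P Γ′ Δ′
    ∧L⁻    : P (A ∧' B ∷ Γ) Δ → P (A ∷ B ∷ Γ) Δ
    ∨L⁻    : P (A ∨' B ∷ Γ) Δ → P (A ∷ Γ) Δ × P (B ∷ Γ) Δ
    ∧R⁻    : P Γ (A ∧' B ∷ Δ) → P Γ (A ∷ Δ) × P Γ (B ∷ Δ)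
    ∨R⁻    : P Γ (A ∨' B ∷ Δ) → P Γ (A ∷ B ∷ Δ)

-- X is pushed up through every rule in which it is not principal, and P must follow it into the
-- premises; only the ∧ and ∨ rules hand their premises a modified context (→R and →LR discard it).
module _ {P : Ctx → Ctx → Set} (closed : InversionClosed P) (Ys : Ctx) {X : Formula}
         (principal : ∀ {Γ Δ} → P Γ Δ → Principalˡ X Γ Δ → Derivable (Ys ++ Γ) Δ) where
  open InversionClosed closed

  replaceˡ : Derivable Γ₀ Δ → Γ₀ ↭ X ∷ Γ → P Γ Δ → Derivable (Ys ++ Γ) Δ

  replaceˡ-under : ∀ {Γ₁ zs} Zs → Derivable Γ₁ Δ → Γ₁ ↭ Zs ++ X ∷ zs → P (Zs ++ zs) Δ →
                   Derivable (Zs ++ Ys ++ zs) Δ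
  replaceˡ-under {zs = zs} Zs d r π =
    reorder (replaceˡ d (r ⟫ shift X Zs zs) π) (shifts Ys Zs) ↭-refl

  replaceˡ (ax p g h) q π with ∈-resp-↭ q (↭∷⇒∈ g)
  ... | here refl = principal π (ax (↭∷ʳ⇒∈ h))
  ... | there m   = ax∈ (∈-++⁺ʳ Ys m) (↭∷ʳ⇒∈ h)
  replaceˡ (⊥L g) q π with ∈-resp-↭ q (↭∷⇒∈ g)
  ... | here refl = principal π ⊥L
  ... | there m   = ⊥L∈ (∈-++⁺ʳ Ys m)
  replaceˡ (∧L {A = A} {B = B} g d) q π with matchHeads (↭-sym g ⟫ q)
  ... | same Γ₁↭Γ = principal π (∧L (reorder d (↭-prep A (↭-prep B Γ₁↭Γ)) ↭-refl))
  ... | other zs Γ₁↭ Γ↭ =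
    ∧L (↭∷-under Ys Γ↭)
       (replaceˡ-under (A ∷ B ∷ []) d (↭-prep A (↭-prep B Γ₁↭)) (∧L⁻ (resp-↭ π Γ↭ ↭-refl)))
  replaceˡ (∨L {A = A} {B = B} g d e) q π with matchHeads (↭-sym g ⟫ q)
  ... | same Γ₁↭Γ =
    principal π (∨L (reorder d (↭-prep A Γ₁↭Γ) ↭-refl) (reorder e (↭-prep B Γ₁↭Γ) ↭-refl))
  ... | other zs Γ₁↭ Γ↭ with πA , πB ← ∨L⁻ (resp-↭ π Γ↭ ↭-refl) =
    ∨L (↭∷-under Ys Γ↭) (replaceˡ-under [ A ] d (↭-prep A Γ₁↭) πA)
                        (replaceˡ-under [ B ] e (↭-prep B Γ₁↭) πB)
  replaceˡ (∧R {Δ = Δ₁} h d e) q π with πA , πB ← ∧R⁻ (resp-↭ π ↭-refl (h ⟫ ∷ʳ↭ Δ₁)) =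
    ∧R h (replaceˡ d q (resp-↭ πA ↭-refl (∷↭∷ʳ _ Δ₁)))
         (replaceˡ e q (resp-↭ πB ↭-refl (∷↭∷ʳ _ Δ₁)))
  replaceˡ (∨R {A = A} {B = B} {Δ = Δ₁} h d) q π =
    ∨R h (replaceˡ d q (resp-↭ (∨R⁻ (resp-↭ π ↭-refl (h ⟫ ∷ʳ↭ Δ₁)))
                               ↭-refl (++-comm (A ∷ B ∷ []) Δ₁)))
  replaceˡ (⇒R h d) q π = ⇒R h d
  replaceˡ (⇒LR g h a b c e) q π with ∈-resp-↭ q (↭∷ʳ⇒∈ g)
  ... | here refl = principal π (⇒LR (↭∷⇒∈ h) (a , b) (c , e))
  ... | there m   = ⇒LR∈ (∈-++⁺ʳ Ys m) (↭∷⇒∈ h) (a , b) (c , e)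

module _ {P : Ctx → Ctx → Set} (closed : InversionClosed P) (Ys : Ctx) {X : Formula}
         (principal : ∀ {Γ Δ} → P Γ Δ → Principalʳ X Γ Δ → Derivable Γ (Ys ++ Δ)) where
  open InversionClosed closed

  replaceʳ : Derivable Γ Δ₀ → Δ₀ ↭ X ∷ Δ → P Γ Δ → Derivable Γ (Ys ++ Δ)

  replaceʳ-under : ∀ {Δ₁ zs} Zs → Derivable Γ Δ₁ → Δ₁ ↭ Zs ++ X ∷ zs → P Γ (Zs ++ zs) →
                   Derivable Γ (Zs ++ Ys ++ zs)
  replaceʳ-under {zs = zs} Zs d r π =
    reorder (replaceʳ d (r ⟫ shift X Zs zs) π) ↭-refl (shifts Ys Zs)

  replaceʳ (ax p g h) q π with ∈-resp-↭ q (↭∷ʳ⇒∈ h)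
  ... | here refl = principal π (ax (↭∷⇒∈ g))
  ... | there m   = ax∈ (↭∷⇒∈ g) (∈-++⁺ʳ Ys m)
  replaceʳ (⊥L g) q π = ⊥L g
  replaceʳ (∧L g d) q π = ∧L g (replaceʳ d q (∧L⁻ (resp-↭ π g ↭-refl)))
  replaceʳ (∨L g d e) q π with πA , πB ← ∨L⁻ (resp-↭ π g ↭-refl) =
    ∨L g (replaceʳ d q πA) (replaceʳ e q πB)
  replaceʳ (∧R {A = A} {B = B} {Δ = Δ₁} h d e) q π with matchHeads (∷↭∷ʳ _ Δ₁ ⟫ ↭-sym h ⟫ q)
  ... | same Δ₁↭Δ =
    principal π (∧R (reorder d ↭-refl (∷ʳ↭ Δ₁ ⟫ ↭-prep A Δ₁↭Δ))
                    (reorder e ↭-refl (∷ʳ↭ Δ₁ ⟫ ↭-prep B Δ₁↭Δ)))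
  ... | other zs Δ₁↭ Δ↭ with πA , πB ← ∧R⁻ (resp-↭ π ↭-refl Δ↭) =
    ∧R↭ (↭∷-under Ys Δ↭) (replaceʳ-under [ A ] d (∷ʳ↭ Δ₁ ⟫ ↭-prep A Δ₁↭) πA)
                         (replaceʳ-under [ B ] e (∷ʳ↭ Δ₁ ⟫ ↭-prep B Δ₁↭) πB)
  replaceʳ (∨R {A = A} {B = B} {Δ = Δ₁} h d) q π with matchHeads (∷↭∷ʳ _ Δ₁ ⟫ ↭-sym h ⟫ q)
  ... | same Δ₁↭Δ =
    principal π (∨R (reorder d ↭-refl (++-comm Δ₁ (A ∷ B ∷ []) ⟫ ↭-prep A (↭-prep B Δ₁↭Δ))))
  ... | other zs Δ₁↭ Δ↭ =
    ∨R↭ (↭∷-under Ys Δ↭)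
        (replaceʳ-under (A ∷ B ∷ []) d (++-comm Δ₁ (A ∷ B ∷ []) ⟫ ↭-prep A (↭-prep B Δ₁↭))
                        (∨R⁻ (resp-↭ π ↭-refl Δ↭)))
  replaceʳ (⇒R h d) q π with ∈-resp-↭ q (↭∷⇒∈ h)
  ... | here refl = principal π (⇒R d)
  ... | there m   = ⇒R∈ (∈-++⁺ʳ Ys m) d
  replaceʳ (⇒LR g h a b c e) q π with ∈-resp-↭ q (↭∷⇒∈ h)
  ... | here refl = principal π (⇒LR (↭∷ʳ⇒∈ g) (a , b) (c , e))
  ... | there m   = ⇒LR∈ (↭∷ʳ⇒∈ g) (∈-++⁺ʳ Ys m) (a , b) (c , e)

⊤-inversionClosed : InversionClosed (λ _ _ → ⊤)
⊤-inversionClosed = record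
  { resp-↭ = λ _ _ _ → tt
  ; ∧L⁻    = λ _ → tt
  ; ∨L⁻    = λ _ → tt , tt
  ; ∧R⁻    = λ _ → tt , tt
  ; ∨R⁻    = λ _ → tt
  }

replaceHeadˡ : ∀ Ys → (∀ {Γ Δ} → Principalˡ X Γ Δ → Derivable (Ys ++ Γ) Δ) →
               Derivable (X ∷ Γ) Δ → Derivable (Ys ++ Γ) Δ
replaceHeadˡ Ys principal d = replaceˡ ⊤-inversionClosed Ys (λ _ → principal) d ↭-refl tt

replaceHeadʳ : ∀ Ys → (∀ {Γ Δ} → Principalʳ X Γ Δ → Derivable Γ (Ys ++ Δ)) →
               Derivable Γ (X ∷ Δ) → Derivable Γ (Ys ++ Δ)
replaceHeadʳ Ys principal d = replaceʳ ⊤-inversionClosed Ys (λ _ → principal) d ↭-refl tt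

∧L⁻¹ : Derivable (A ∧' B ∷ Γ) Δ → Derivable (A ∷ B ∷ Γ) Δ
∧L⁻¹ {A = A} {B} = replaceHeadˡ (A ∷ B ∷ []) λ { (∧L d) → d }

∨L⁻¹ : Derivable (A ∨' B ∷ Γ) Δ → Derivable (A ∷ Γ) Δ × Derivable (B ∷ Γ) Δ
∨L⁻¹ {A = A} {B} d =
  replaceHeadˡ [ A ] (λ { (∨L d e) → d }) d , replaceHeadˡ [ B ] (λ { (∨L d e) → e }) d

∧R⁻¹ : Derivable Γ (A ∧' B ∷ Δ) → Derivable Γ (A ∷ Δ) × Derivable Γ (B ∷ Δ)
∧R⁻¹ {A = A} {B} d =
  replaceHeadʳ [ A ] (λ { (∧R d e) → d }) d , replaceHeadʳ [ B ] (λ { (∧R d e) → e }) d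

∨R⁻¹ : Derivable Γ (A ∨' B ∷ Δ) → Derivable Γ (A ∷ B ∷ Δ)
∨R⁻¹ {A = A} {B} = replaceHeadʳ (A ∷ B ∷ []) λ { (∨R d) → d }

derivable-inversionClosed : InversionClosed Derivable
derivable-inversionClosed = record
  { resp-↭ = reorder
  ; ∧L⁻    = ∧L⁻¹
  ; ∨L⁻    = ∨L⁻¹
  ; ∧R⁻    = ∧R⁻¹
  ; ∨R⁻    = ∨R⁻¹
  }

∷ˡ-inversionClosed : {P : Ctx → Ctx → Set} → InversionClosed P → InversionClosed (λ Γ → P (D ∷ Γ))
∷ˡ-inversionClosed {D = D} {P} closed = record
  { resp-↭ = λ π g → resp-↭ π (↭-prep D g)
  ; ∧L⁻    = λ π → resp-↭ (∧L⁻ (swap π)) (shifts (_ ∷ _ ∷ []) [ D ]) ↭-refl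
  ; ∨L⁻    = λ π → let πA , πB = ∨L⁻ (swap π) in swap πA , swap πB
  ; ∧R⁻    = ∧R⁻
  ; ∨R⁻    = ∨R⁻
  }
  where
  open InversionClosed closed

  swap : P (X ∷ Z ∷ Γ) Δ → P (Z ∷ X ∷ Γ) Δ
  swap π = resp-↭ π (↭-swap _ _ ↭-refl) ↭-refl

-- No left rule decomposes these formulas, so an occurrence in the context persists into every
-- premise that keeps the context.
data Persistent : Formula → Set where
  atom : ∀ p → Persistent (atom p)
  ⊥'   : Persistent ⊥'
  _⇒'_ : ∀ A B → Persistent (A ⇒' B)

persistent-∈-tail : Persistent Z → Z ∈ X ∷ Γ → ¬ Persistent X → Z ∈ Γ
persistent-∈-tail z (here refl) ¬persistent = ⊥-elim (¬persistent z)
persistent-∈-tail z (there m)   _           = m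

∈-inversionClosed : Persistent Z → InversionClosed (λ Γ _ → Z ∈ Γ)
∈-inversionClosed z = record
  { resp-↭ = λ m g _ → ∈-resp-↭ g m
  ; ∧L⁻    = λ m → there (there (persistent-∈-tail z m λ ()))
  ; ∨L⁻    = λ m → there (persistent-∈-tail z m λ ()) , there (persistent-∈-tail z m λ ())
  ; ∧R⁻    = λ m → m , m
  ; ∨R⁻    = λ m → m
  }

contractˡ : Persistent Z → Z ∈ Γ → Derivable (Z ∷ Γ) Δ → Derivable Γ Δ
contractˡ z m d = replaceˡ (∈-inversionClosed z) [] (principal z) d ↭-refl m
  where
  principal : Persistent Z → Z ∈ Γ → Principalˡ Z Γ Δ → Derivable Γ Δ
  principal _ m (ax n)      = ax∈ m n
  principal _ m ⊥L          = ⊥L∈ m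
  principal _ m (⇒LR n a c) = ⇒LR∈ m n a c
  principal () _ (∧L _)
  principal () _ (∨L _ _)

weakenˡ : ∀ A → Derivable Γ Δ → Derivable (A ∷ Γ) Δ
weakenˡ {Γ} {Δ} A d = reorder (weaken [ A ] [] d) (∷ʳ↭ Γ) (++-identityʳ Δ)

weakenʳ : ∀ A → Derivable Γ Δ → Derivable Γ (A ∷ Δ)
weakenʳ {Γ} {Δ} A d = reorder (weaken [] [ A ] d) (++-identityʳ Γ) (∷ʳ↭ Δ)

CutAdmissible : Formula → Set
CutAdmissible D = ∀ {Γ Δ} → Derivable Γ (D ∷ Δ) → Derivable (D ∷ Γ) Δ → Derivable Γ Δ

⊢-trans : CutAdmissible B → A ⊢ B → B ⊢ C → A ⊢ C
⊢-trans {A = A} {C = C} cutB a⊢b b⊢c = cutB (weaken [] [ C ] a⊢b) (weaken [ A ] [] b⊢c)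

⟺-trans : CutAdmissible B → A ⟺ B → B ⟺ C → A ⟺ C
⟺-trans cutB (a , a′) (b , b′) = ⊢-trans cutB a b , ⊢-trans cutB b′ a′

⇒-removeˡ : CutAdmissible A → CutAdmissible B → A ⊢ B →
            Derivable (A ⇒' B ∷ Γ) Δ → Derivable Γ Δ
⇒-removeˡ cutA cutB a⊢b = replaceHeadˡ []
  λ { (⇒LR m (_ , a′⊢a) (b⊢b′ , _)) → ⇒R∈ m (⊢-trans cutA a′⊢a (⊢-trans cutB a⊢b b⊢b′)) }

⇒-congˡ : CutAdmissible B → CutAdmissible E → A ⟺ B → C ⟺ E →
          Derivable (B ⇒' E ∷ Γ) Δ → Derivable (A ⇒' C ∷ Γ) Δ
⇒-congˡ {A = A} {C = C} cutB cutE a⟺b c⟺e = replaceHeadˡ [ A ⇒' C ]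
  λ { (⇒LR m b⟺b′ e⟺e′) → ⇒LR∈ (here refl) m (⟺-trans cutB a⟺b b⟺b′) (⟺-trans cutE c⟺e e⟺e′) }

cut : ∀ D → CutAdmissible D

principal-cut : ∀ D → Derivable (D ∷ Γ) Δ → Principalʳ D Γ Δ → Derivable Γ Δ
principal-cut (atom p) e (ax m) = contractˡ (atom p) m e
principal-cut (A ∧' B) e (∧R d₁ d₂) =
  cut A d₁ (cut B (weakenˡ A d₂) (reorder (∧L⁻¹ e) (↭-swap A B ↭-refl) ↭-refl))
principal-cut (A ∨' B) e (∨R d) with eA , eB ← ∨L⁻¹ e =
  cut A (cut B (reorder d ↭-refl (↭-swap A B ↭-refl)) (weakenʳ A eB)) eA
principal-cut (A ⇒' B) e (⇒R d) = ⇒-removeˡ (cut A) (cut B) d e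
principal-cut (B ⇒' E) e (⇒LR m a⟺b c⟺e) =
  contractˡ (_ ⇒' _) m (⇒-congˡ (cut B) (cut E) a⟺b c⟺e e)

cut D d e = replaceʳ (∷ˡ-inversionClosed derivable-inversionClosed) [] (principal-cut D) d ↭-refl e

mainTheorem3 : (Γ Γ′ Δ Δ′ : List Formula) (D : Formula) →
    Derivable Γ (D ∷ Δ) → Derivable (D ∷ Γ′) Δ′ →
    Derivable (Γ ++ Γ′) (Δ ++ Δ′)
mainTheorem3 Γ Γ′ Δ Δ′ D d e =
  cut D (weaken Γ′ Δ′ d) (reorder (weaken Γ Δ e) (↭-prep D (++-comm Γ′ Γ)) (++-comm Δ′ Δ))
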